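{- Let $\lambda$ be a nonzero real number. Then $$d_{n,\lambda}(x)=\sum_{l=0}^{n}\binom{n}{l}d_{l,\lambda}\,(x)_{n-l,\lambda}\quad (n\ge 0),$$ $$(x-1)_{n,\lambda}=d_{n,\lambda}(x)-n\,d_{n-1,\lambda}(x)\quad(n\ge1),$$ $$(-1)_{n,\lambda}=d_{n,\lambda}-n\,d_{n-1,\lambda}\quad(n\ge1).$$
   Context: For a nonzero real $\lambda$, the degenerate falling factorial is $(x)_{0,\lambda}=1$ and $(x)_{n,\lambda}=x(x-\lambda)\cdots(x-(n-1)\lambda)$ for $n\ge1$. The degenerate exponential function is $e_{\lambda}^{x}(t)=(1+\lambda t)^{x/\lambda}=\sum_{n\ge0}(x)_{n,\lambda}\frac{t^n}{n!}$ (as a formal power series in $t$). The degenerate derangement polynomials $d_{n,\lambda}(x)$ are defined by $$\frac{1}{1-t}e_{\lambda}^{x-1}(t)=\sum_{n=0}^{\infty}d_{n,\lambda}(x)\frac{t^n}{n!},$$ and the degenerate derangement numbers are $d_{n,\lambda}=d_{n,\lambda}(0)$. -}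

module Defs where

open import Level using (Level)
open import Algebra.Bundles using (CommutativeRing)
open import Data.Nat using (ℕ; zero; suc; _∸_)
open import Data.Nat.Combinatorics using (_C_)
open import Data.Nat.Base using (_!)

-- All notions are developed over an arbitrary commutative ring R
-- (the paper works over the reals).
module Deg {c ℓ : Level} (R : CommutativeRing c ℓ) where
  open CommutativeRing R

  fromℕ : ℕ → Carrier
  fromℕ zero    = 0#
  fromℕ (suc n) = 1# + fromℕ n

  sumTo : ℕ → (ℕ → Carrier) → Carrier
  sumTo zero    f = f 0
  sumTo (suc n) f = sumTo n f + f (suc n)

  fall : (lam x : Carrier) → ℕ → Carrier
  fall lam x zero    = 1#
  fall lam x (suc n) = x * fall lam (x - lam) n

  -- Exponential generating functions are represented by their coefficient
  -- sequences a, meaning Σ a n t^n / n!.  Product of EGFs: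
  egfMul : (ℕ → Carrier) → (ℕ → Carrier) → ℕ → Carrier
  egfMul f g n = sumTo n (λ k → fromℕ (n C k) * (f k * g (n ∸ k)))

  -- 1/(1-t) = Σ n! t^n/n!
  geomEGF : ℕ → Carrier
  geomEGF n = fromℕ (n !)

  -- degenerate exponential e_λ^x(t) = Σ (x)_{n,λ} t^n/n!
  degExp : (lam x : Carrier) → ℕ → Carrier
  degExp lam x = fall lam x

  -- degenerate derangement polynomials: Σ d_{n,λ}(x) t^n/n! = 1/(1-t) · e_λ^{x-1}(t)
  dpoly : (lam : Carrier) → ℕ → Carrier → Carrier
  dpoly lam n x = egfMul geomEGF (degExp lam (x - 1#)) n

  dnum : (lam : Carrier) → ℕ → Carrier
  dnum lam n = dpoly lam n 0#

-- Exponential generating functions are handled through their coefficient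
-- sequences, with the binomial convolution egfMul as product.  This product
-- is associative (by induction on the degree, using the Leibniz rule for the
-- coefficient shift), and the degenerate falling factorials satisfy the
-- Vandermonde identity (a + b)_{n,λ} = Σ C(n,k) (a)_{k,λ} (b)_{n-k,λ}, i.e.
-- e_λ^{a+b} = e_λ^a e_λ^b.  Hence
--   1/(1-t) · e_λ^{x-1} = (1/(1-t) · e_λ^{-1}) · e_λ^x = (Σ d_{l,λ} t^l/l!) · e_λ^x,
-- which is the first identity.  Multiplying Σ d_{n,λ}(x) t^n/n! by 1 - t gives
-- back e_λ^{x-1}; on coefficients this is the second identity, and x = 0 gives
-- the third.  Nothing here uses λ ≠ 0.
module Submission where

open import Defs
open import Level using (Level)
open import Algebra.Bundles using (CommutativeRing)
open import Data.Nat as ℕ using (ℕ; zero; suc; _∸_; _!)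
open import Data.Nat.Combinatorics
  using (_C_; nC1≡n; k>n⇒nCk≡0; nCk+nC[k+1]≡[n+1]C[k+1])
import Data.Nat.Properties as ℕ
open import Data.Nat.Tactic.RingSolver using (solve-∀)
open import Data.Product using (_×_; _,_)
open import Relation.Nullary using (¬_)
open import Relation.Binary.PropositionalEquality as ≡ using (_≡_)
import Algebra.Properties.CommutativeSemigroup as CommSemigroupProperties
import Algebra.Properties.Semiring.Mult as SemiringMult
import Relation.Binary.Reasoning.Setoid as SetoidReasoning

[k+1]*[n+1]C[k+1]≡[n+1]*nCk : ∀ n k → suc k ℕ.* (suc n C suc k) ≡ suc n ℕ.* (n C k)
[k+1]*[n+1]C[k+1]≡[n+1]*nCk zero    zero    = ≡.refl
[k+1]*[n+1]C[k+1]≡[n+1]*nCk zero    (suc k)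
  rewrite k>n⇒nCk≡0 {1} {suc (suc k)} (ℕ.s≤s (ℕ.s≤s ℕ.z≤n))
        | k>n⇒nCk≡0 {0} {suc k} (ℕ.s≤s ℕ.z≤n)
        = ℕ.*-zeroʳ (suc (suc k))
[k+1]*[n+1]C[k+1]≡[n+1]*nCk (suc n) zero    =
  ≡.trans (ℕ.*-identityˡ _) (≡.trans (nC1≡n (suc (suc n))) (≡.sym (ℕ.*-identityʳ _)))
[k+1]*[n+1]C[k+1]≡[n+1]*nCk (suc n) (suc j) = begin
  suc (suc j) ℕ.* (suc (suc n) C suc (suc j))
    ≡⟨ ≡.cong (suc (suc j) ℕ.*_) (≡.sym (nCk+nC[k+1]≡[n+1]C[k+1] (suc n) (suc j))) ⟩
  suc (suc j) ℕ.* (a ℕ.+ b)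
    ≡⟨ rearrange j a b ⟩
  a ℕ.+ (suc j ℕ.* a ℕ.+ suc (suc j) ℕ.* b)
    ≡⟨ ≡.cong (a ℕ.+_) (≡.cong₂ ℕ._+_ ([k+1]*[n+1]C[k+1]≡[n+1]*nCk n j)
                                        ([k+1]*[n+1]C[k+1]≡[n+1]*nCk n (suc j))) ⟩
  a ℕ.+ (suc n ℕ.* (n C j) ℕ.+ suc n ℕ.* (n C suc j))
    ≡⟨ ≡.cong (a ℕ.+_) (≡.sym (ℕ.*-distribˡ-+ (suc n) (n C j) (n C suc j))) ⟩
  a ℕ.+ suc n ℕ.* ((n C j) ℕ.+ (n C suc j))
    ≡⟨ ≡.cong (λ c → a ℕ.+ suc n ℕ.* c) (nCk+nC[k+1]≡[n+1]C[k+1] n j) ⟩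
  suc (suc n) ℕ.* a ∎
  where
  open ≡.≡-Reasoning
  a = suc n C suc j
  b = suc n C suc (suc j)
  rearrange : ∀ j a b → suc (suc j) ℕ.* (a ℕ.+ b) ≡ a ℕ.+ (suc j ℕ.* a ℕ.+ suc (suc j) ℕ.* b)
  rearrange = solve-∀

[n+1]C[k+1]*[k+1]!≡[n+1]*nCk*k! : ∀ n k →
  (suc n C suc k) ℕ.* (suc k) ! ≡ suc n ℕ.* ((n C k) ℕ.* k !)
[n+1]C[k+1]*[k+1]!≡[n+1]*nCk*k! n k = begin
  (suc n C suc k) ℕ.* (suc k ℕ.* k !)   ≡⟨ ℕ.*-assoc (suc n C suc k) (suc k) (k !) ⟨
  (suc n C suc k) ℕ.* suc k ℕ.* k !     ≡⟨ ≡.cong (ℕ._* k !) (ℕ.*-comm (suc n C suc k) (suc k)) ⟩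
  suc k ℕ.* (suc n C suc k) ℕ.* k !     ≡⟨ ≡.cong (ℕ._* k !) ([k+1]*[n+1]C[k+1]≡[n+1]*nCk n k) ⟩
  suc n ℕ.* (n C k) ℕ.* k !             ≡⟨ ℕ.*-assoc (suc n) (n C k) (k !) ⟩
  suc n ℕ.* ((n C k) ℕ.* k !)           ∎
  where open ≡.≡-Reasoning

module DerangementIdentities {c ℓ : Level} (R : CommutativeRing c ℓ) where
  open CommutativeRing R
  open Deg R
  open SetoidReasoning setoid
  open SemiringMult semiring using (×-homo-+; ×1-homo-*) renaming (_×_ to _·_)
  module +-Props = CommSemigroupProperties +-commutativeSemigroup
  module *-Props = CommSemigroupProperties *-commutativeSemigroup

  Seq : Set c
  Seq = ℕ → Carrier

  fromℕ≡·1# : ∀ n → fromℕ n ≡ n · 1#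
  fromℕ≡·1# zero    = ≡.refl
  fromℕ≡·1# (suc n) = ≡.cong (1# +_) (fromℕ≡·1# n)

  fromℕ-+ : ∀ m n → fromℕ (m ℕ.+ n) ≈ fromℕ m + fromℕ n
  fromℕ-+ m n rewrite fromℕ≡·1# (m ℕ.+ n) | fromℕ≡·1# m | fromℕ≡·1# n = ×-homo-+ 1# m n

  fromℕ-* : ∀ m n → fromℕ (m ℕ.* n) ≈ fromℕ m * fromℕ n
  fromℕ-* m n rewrite fromℕ≡·1# (m ℕ.* n) | fromℕ≡·1# m | fromℕ≡·1# n = ×1-homo-* m n

  x≈y+z⇒y≈x-z : ∀ {x y z} → x ≈ y + z → y ≈ x - z
  x≈y+z⇒y≈x-z {x} {y} {z} x≈y+z = sym (begin
    x - z         ≈⟨ +-congʳ x≈y+z ⟩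
    y + z - z     ≈⟨ +-assoc y z (- z) ⟩
    y + (z - z)   ≈⟨ +-congˡ (-‿inverseʳ z) ⟩
    y + 0#        ≈⟨ +-identityʳ y ⟩
    y             ∎)

  sumTo-cong : ∀ n {f g : Seq} → (∀ k → k ℕ.≤ n → f k ≈ g k) → sumTo n f ≈ sumTo n g
  sumTo-cong zero    f≈g = f≈g 0 ℕ.z≤n
  sumTo-cong (suc n) f≈g =
    +-cong (sumTo-cong n (λ k k≤n → f≈g k (ℕ.m≤n⇒m≤1+n k≤n))) (f≈g (suc n) ℕ.≤-refl)

  sumTo-suc : ∀ n f → sumTo (suc n) f ≈ f 0 + sumTo n (λ k → f (suc k))
  sumTo-suc zero    f = refl
  sumTo-suc (suc n) f = trans (+-congʳ (sumTo-suc n f)) (+-assoc _ _ _)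

  sumTo-+ : ∀ n f g → sumTo n (λ k → f k + g k) ≈ sumTo n f + sumTo n g
  sumTo-+ zero    f g = refl
  sumTo-+ (suc n) f g = trans (+-congʳ (sumTo-+ n f g)) (+-Props.interchange _ _ _ _)

  *-distribˡ-sumTo : ∀ n a f → a * sumTo n f ≈ sumTo n (λ k → a * f k)
  *-distribˡ-sumTo zero    a f = refl
  *-distribˡ-sumTo (suc n) a f = trans (distribˡ _ _ _) (+-congʳ (*-distribˡ-sumTo n a f))

  egfMul-cong : ∀ {f f′ g g′ : Seq} → (∀ k → f k ≈ f′ k) → (∀ k → g k ≈ g′ k) →
                ∀ n → egfMul f g n ≈ egfMul f′ g′ n
  egfMul-cong f≈f′ g≈g′ n = sumTo-cong n (λ k _ → *-congˡ (*-cong (f≈f′ k) (g≈g′ (n ∸ k))))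

  egfMul-distribˡ : ∀ (f g h : Seq) n →
                    egfMul f (λ k → g k + h k) n ≈ egfMul f g n + egfMul f h n
  egfMul-distribˡ f g h n =
    trans (sumTo-cong n (λ k _ → trans (*-congˡ (distribˡ _ _ _)) (distribˡ _ _ _))) (sumTo-+ n _ _)

  egfMul-distribʳ : ∀ (f g h : Seq) n →
                    egfMul (λ k → f k + g k) h n ≈ egfMul f h n + egfMul g h n
  egfMul-distribʳ f g h n =
    trans (sumTo-cong n (λ k _ → trans (*-congˡ (distribʳ _ _ _)) (distribˡ _ _ _))) (sumTo-+ n _ _)

  *-egfMulˡ : ∀ a (f g : Seq) n → a * egfMul f g n ≈ egfMul (λ k → a * f k) g n
  *-egfMulˡ a f g n = trans (*-distribˡ-sumTo n a _)
    (sumTo-cong n (λ k _ → trans (*-Props.x∙yz≈y∙xz _ _ _) (*-congˡ (sym (*-assoc _ _ _)))))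

  *-egfMulʳ : ∀ a (f g : Seq) n → a * egfMul f g n ≈ egfMul f (λ k → a * g k) n
  *-egfMulʳ a f g n = trans (*-distribˡ-sumTo n a _)
    (sumTo-cong n (λ k _ → trans (*-Props.x∙yz≈y∙xz _ _ _) (*-congˡ (*-Props.x∙yz≈y∙xz _ _ _))))

  -- The coefficient shift f ↦ f ∘ suc is the derivative of an EGF.
  egfMul-suc : ∀ (f g : Seq) n →
    egfMul f g (suc n) ≈ egfMul (λ k → f (suc k)) g n + egfMul f (λ k → g (suc k)) n
  egfMul-suc f g n = begin
    egfMul f g (suc n)
      ≈⟨ sumTo-suc n T ⟩
    T 0 + sumTo n (λ k → T (suc k))
      ≈⟨ +-congˡ (trans (sumTo-cong n (λ k _ → pascal k)) (sumTo-+ n _ _)) ⟩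
    T 0 + (egfMul f′ g n + sumTo n (λ k → U (suc k)))
      ≈⟨ +-Props.x∙yz≈y∙xz _ _ _ ⟩
    egfMul f′ g n + (U 0 + sumTo n (λ k → U (suc k)))
      ≈⟨ +-congˡ (sumTo-suc n U) ⟨
    egfMul f′ g n + (sumTo n U + U (suc n))
      ≈⟨ +-congˡ (trans (+-congˡ last-vanishes) (+-identityʳ _)) ⟩
    egfMul f′ g n + sumTo n U
      ≈⟨ +-congˡ (sumTo-cong n (λ k k≤n → *-congˡ (*-congˡ (reflexive (≡.cong g (ℕ.+-∸-assoc 1 k≤n)))))) ⟩
    egfMul f′ g n + egfMul f (λ k → g (suc k)) n ∎
    where
    f′ : Seq
    f′ k = f (suc k)
    T U : Seq
    T k = fromℕ (suc n C k) * (f k * g (suc n ∸ k))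
    U k = fromℕ (n C k) * (f k * g (suc n ∸ k))
    pascal : ∀ k → T (suc k) ≈ fromℕ (n C k) * (f′ k * g (n ∸ k)) + U (suc k)
    pascal k = trans (*-congʳ (trans (reflexive (≡.cong fromℕ (≡.sym (nCk+nC[k+1]≡[n+1]C[k+1] n k))))
                                     (fromℕ-+ (n C k) (n C suc k))))
                     (distribʳ _ _ _)
    last-vanishes : U (suc n) ≈ 0#
    last-vanishes = trans (*-congʳ (reflexive (≡.cong fromℕ (k>n⇒nCk≡0 (ℕ.n<1+n n))))) (zeroˡ _)

  egfMul-assoc : ∀ (f g h : Seq) n → egfMul (egfMul f g) h n ≈ egfMul f (egfMul g h) n
  egfMul-assoc f g h zero = *-congˡ (trans (*-assoc _ _ _)
    (trans (*-congˡ (*-assoc _ _ _)) (*-Props.x∙yz≈y∙xz _ _ _)))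
  egfMul-assoc f g h (suc n) = begin
    egfMul (egfMul f g) h (suc n)
      ≈⟨ egfMul-suc (egfMul f g) h n ⟩
    egfMul (λ k → egfMul f g (suc k)) h n + egfMul (egfMul f g) h′ n
      ≈⟨ +-congʳ (egfMul-cong {g = h} {g′ = h} (egfMul-suc f g) (λ _ → refl) n) ⟩
    egfMul (λ k → egfMul f′ g k + egfMul f g′ k) h n + egfMul (egfMul f g) h′ n
      ≈⟨ +-congʳ (egfMul-distribʳ (egfMul f′ g) (egfMul f g′) h n) ⟩
    (egfMul (egfMul f′ g) h n + egfMul (egfMul f g′) h n) + egfMul (egfMul f g) h′ n
      ≈⟨ +-cong (+-cong (egfMul-assoc f′ g h n) (egfMul-assoc f g′ h n)) (egfMul-assoc f g h′ n) ⟩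
    (egfMul f′ (egfMul g h) n + egfMul f (egfMul g′ h) n) + egfMul f (egfMul g h′) n
      ≈⟨ +-assoc _ _ _ ⟩
    egfMul f′ (egfMul g h) n + (egfMul f (egfMul g′ h) n + egfMul f (egfMul g h′) n)
      ≈⟨ +-congˡ (sym (egfMul-distribˡ f (egfMul g′ h) (egfMul g h′) n)) ⟩
    egfMul f′ (egfMul g h) n + egfMul f (λ k → egfMul g′ h k + egfMul g h′ k) n
      ≈⟨ +-congˡ (egfMul-cong (λ _ → refl) (λ k → sym (egfMul-suc g h k)) n) ⟩
    egfMul f′ (egfMul g h) n + egfMul f (λ k → egfMul g h (suc k)) n
      ≈⟨ egfMul-suc f (egfMul g h) n ⟨
    egfMul f (egfMul g h) (suc n) ∎
    where
    f′ g′ h′ : Seq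
    f′ k = f (suc k)
    g′ k = g (suc k)
    h′ k = h (suc k)

  -- Multiplication by 1 - t inverts 1/(1 - t).
  egfMul-geomEGF-suc : ∀ (g : Seq) n →
    egfMul geomEGF g (suc n) ≈ g (suc n) + fromℕ (suc n) * egfMul geomEGF g n
  egfMul-geomEGF-suc g n = begin
    egfMul geomEGF g (suc n)             ≈⟨ sumTo-suc n T ⟩
    T 0 + sumTo n (λ k → T (suc k))      ≈⟨ +-cong first-term (sumTo-cong n (λ k _ → absorb k)) ⟩
    g (suc n) + sumTo n (λ k → fromℕ (suc n) * U k)  ≈⟨ +-congˡ (*-distribˡ-sumTo n (fromℕ (suc n)) U) ⟨
    g (suc n) + fromℕ (suc n) * egfMul geomEGF g n   ∎
    where
    T U : Seq
    T k = fromℕ (suc n C k) * (fromℕ (k !) * g (suc n ∸ k))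
    U k = fromℕ (n C k) * (fromℕ (k !) * g (n ∸ k))
    first-term : T 0 ≈ g (suc n)
    first-term = trans (*-congʳ (+-identityʳ 1#)) (trans (*-identityˡ _)
                 (trans (*-congʳ (+-identityʳ 1#)) (*-identityˡ _)))
    absorb : ∀ k → T (suc k) ≈ fromℕ (suc n) * U k
    absorb k = begin
      fromℕ (suc n C suc k) * (fromℕ (suc k !) * g (n ∸ k))
        ≈⟨ *-assoc _ _ _ ⟨
      fromℕ (suc n C suc k) * fromℕ (suc k !) * g (n ∸ k)
        ≈⟨ *-congʳ coefficient ⟩
      fromℕ (suc n) * (fromℕ (n C k) * fromℕ (k !)) * g (n ∸ k)
        ≈⟨ trans (*-assoc _ _ _) (*-congˡ (*-assoc _ _ _)) ⟩
      fromℕ (suc n) * U k ∎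
      where
      coefficient : fromℕ (suc n C suc k) * fromℕ (suc k !) ≈ fromℕ (suc n) * (fromℕ (n C k) * fromℕ (k !))
      coefficient = begin
        fromℕ (suc n C suc k) * fromℕ (suc k !)       ≈⟨ fromℕ-* (suc n C suc k) (suc k !) ⟨
        fromℕ ((suc n C suc k) ℕ.* suc k !)           ≡⟨ ≡.cong fromℕ ([n+1]C[k+1]*[k+1]!≡[n+1]*nCk*k! n k) ⟩
        fromℕ (suc n ℕ.* ((n C k) ℕ.* k !))           ≈⟨ fromℕ-* (suc n) ((n C k) ℕ.* k !) ⟩
        fromℕ (suc n) * fromℕ ((n C k) ℕ.* k !)       ≈⟨ *-congˡ (fromℕ-* (n C k) (k !)) ⟩
        fromℕ (suc n) * (fromℕ (n C k) * fromℕ (k !)) ∎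

  fall-cong : ∀ lam {x y} → x ≈ y → ∀ n → fall lam x n ≈ fall lam y n
  fall-cong lam x≈y zero    = refl
  fall-cong lam x≈y (suc n) = *-cong x≈y (fall-cong lam (+-congʳ x≈y) n)

  fall-+ : ∀ lam a b n → fall lam (a + b) n ≈ egfMul (fall lam a) (fall lam b) n
  fall-+ lam a b zero =
    sym (trans (*-congʳ (+-identityʳ 1#)) (trans (*-identityˡ _) (*-identityˡ _)))
  fall-+ lam a b (suc n) = begin
    (a + b) * fall lam (a + b - lam) n
      ≈⟨ distribʳ _ _ _ ⟩
    a * fall lam (a + b - lam) n + b * fall lam (a + b - lam) n
      ≈⟨ +-cong (*-congˡ (trans (fall-cong lam (+-Props.xy∙z≈xz∙y a b (- lam)) n) (fall-+ lam (a - lam) b n)))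
                (*-congˡ (trans (fall-cong lam (+-assoc a b (- lam)) n) (fall-+ lam a (b - lam) n))) ⟩
    a * egfMul (fall lam (a - lam)) (fall lam b) n + b * egfMul (fall lam a) (fall lam (b - lam)) n
      ≈⟨ +-cong (*-egfMulˡ a (fall lam (a - lam)) (fall lam b) n)
                (*-egfMulʳ b (fall lam a) (fall lam (b - lam)) n) ⟩
    egfMul (λ k → fall lam a (suc k)) (fall lam b) n + egfMul (fall lam a) (λ k → fall lam b (suc k)) n
      ≈⟨ egfMul-suc (fall lam a) (fall lam b) n ⟨
    egfMul (fall lam a) (fall lam b) (suc n) ∎

  dpoly-binomial : ∀ lam x n →
    dpoly lam n x ≈ sumTo n (λ l → fromℕ (n C l) * (dnum lam l * fall lam x (n ∸ l)))
  dpoly-binomial lam x n = begin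
    egfMul geomEGF (fall lam (x - 1#)) n
      ≈⟨ egfMul-cong (λ _ → refl) (λ k → trans (fall-cong lam x-1≈[0-1]+x k) (fall-+ lam (0# - 1#) x k)) n ⟩
    egfMul geomEGF (egfMul (fall lam (0# - 1#)) (fall lam x)) n
      ≈⟨ egfMul-assoc geomEGF (fall lam (0# - 1#)) (fall lam x) n ⟨
    egfMul (dnum lam) (fall lam x) n ∎
    where
    x-1≈[0-1]+x : x - 1# ≈ 0# - 1# + x
    x-1≈[0-1]+x = trans (+-comm x (- 1#)) (+-congʳ (sym (+-identityˡ (- 1#))))

  fall-dpoly : ∀ lam x n →
    fall lam (x - 1#) (suc n) ≈ dpoly lam (suc n) x - fromℕ (suc n) * dpoly lam n x
  fall-dpoly lam x n = x≈y+z⇒y≈x-z (egfMul-geomEGF-suc (fall lam (x - 1#)) n)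

  fall-dnum : ∀ lam n → fall lam (- 1#) (suc n) ≈ dnum lam (suc n) - fromℕ (suc n) * dnum lam n
  fall-dnum lam n = trans (fall-cong lam (sym (+-identityˡ (- 1#))) (suc n)) (fall-dpoly lam 0# n)

theorem2 : {c ℓ : Level} (R : CommutativeRing c ℓ) →
    let open CommutativeRing R in let open Deg R in
    (lam : Carrier) → ¬ (lam ≈ 0#) →
      ((x : Carrier) (n : ℕ) →
        dpoly lam n x ≈ sumTo n (λ l → fromℕ (n C l) * (dnum lam l * fall lam x (n ∸ l))))
      × ((x : Carrier) (n : ℕ) →
        fall lam (x - 1#) (suc n) ≈ dpoly lam (suc n) x - fromℕ (suc n) * dpoly lam n x)
      × ((n : ℕ) →
        fall lam (- 1#) (suc n) ≈ dnum lam (suc n) - fromℕ (suc n) * dnum lam n)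
theorem2 R lam _ = dpoly-binomial lam , fall-dpoly lam , fall-dnum lam
  where open DerangementIdentities R
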